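{- Let \(G\) be a finite simple connected graph with \(\Delta(G)\le 4\) that is not the octahedron, and let \(T,T'\) be inner triangles of \(G\) with \(T\cap T'=\{x,y\}\). Then \(N(x)\) induces a 4-cycle, the only ear of \(Q_T\) that is an inner triangle is \(T'\), and the only normal vertices of \(T\) are \(x\) and \(y\).
   Context: A clique is a maximal complete subgraph; \(K(G)\) is the intersection graph of the cliques of \(G\), \(K^2(G)=K(K(G))\). A triangle is a complete subgraph on three vertices. A triangle \(T\) is inner if \(T\) is a clique of \(G\) and for each edge \(e\) of \(T\) there is a triangle \(T'\ne T\) with \(T\cap T'=e\). For an inner triangle \(T\), \(Q_T=\{q\in K(G): |q\cap T|\ge 2\}\), and the elements of \(Q_T\) other than \(T\) are its ears. For \(x\in G\), the star \(x^*=\{q\in K(G): x\in q\}\); \(x\) is a normal vertex if \(x^*\) is a clique of \(K(G)\). \(N(x)\) is the set of neighbors of \(x\). The octahedron is \(K_{2,2,2}\). -}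

module Defs where

open import Data.Nat using (ℕ; _≤_; _≥_; _/_; _≡ᵇ_)
open import Data.Bool using (Bool; true; false; not; T; _∨_)
open import Data.Fin using (Fin; toℕ)
open import Data.Fin.Properties using (_≟_)
open import Data.Fin.Subset using (Subset; _∈_; _∉_; _⊆_; _∩_; _∪_; ∣_∣; ⁅_⁆)
open import Data.Vec using (tabulate)
open import Data.Product using (Σ; ∃; _×_; _,_)
open import Data.Sum using (_⊎_)
open import Relation.Nullary using (¬_; does)
open import Relation.Binary.PropositionalEquality using (_≡_; _≢_)
open import Function.Bundles using (_↔_; Inverse)
open import Level using (Level; suc; zero)

record Graph (n : ℕ) : Set where
  field
    E     : Fin n → Fin n → Bool
    sym   : ∀ u v → E u v ≡ E v u
    irref : ∀ u → E u u ≡ false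
open Graph public

module _ {n : ℕ} (G : Graph n) where

  Adj : Fin n → Fin n → Set
  Adj u v = T (E G u v)

  N : Fin n → Subset n
  N x = tabulate (E G x)

  MaxDegreeAtMost : ℕ → Set
  MaxDegreeAtMost k = ∀ x → ∣ N x ∣ ≤ k

  data Reach (u : Fin n) : Fin n → Set where
    here : Reach u u
    step : ∀ {v w} → Reach u v → Adj v w → Reach u w

  Connected : Set
  Connected = ∀ u v → Reach u v

  Complete : Subset n → Set
  Complete S = ∀ u v → u ∈ S → v ∈ S → u ≢ v → Adj u v

  IsClique : Subset n → Set
  IsClique S = Complete S × (∀ S' → Complete S' → S ⊆ S' → S' ⊆ S)

  IsTriangle : Subset n → Set
  IsTriangle S = Complete S × ∣ S ∣ ≡ 3

  IsEdgeOf : Subset n → Subset n → Set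
  IsEdgeOf e S = e ⊆ S × ∣ e ∣ ≡ 2

  IsInnerTriangle : Subset n → Set
  IsInnerTriangle t =
    IsTriangle t × IsClique t ×
    (∀ e → IsEdgeOf e t → Σ (Subset n) λ t' → IsTriangle t' × t' ≢ t × (t ∩ t') ≡ e)

  InQ : Subset n → Subset n → Set
  InQ t q = IsClique q × ∣ q ∩ t ∣ ≥ 2

  IsEar : Subset n → Subset n → Set
  IsEar t q = InQ t q × q ≢ t

  -- Sets of vertices of K(G) are predicates on subsets of vertices of G.
  Family : Set₁
  Family = Subset n → Set

  -- complete subgraph of K(G): a set of cliques of G, pairwise
  -- adjacent in K(G) (distinct ones intersect)
  CompleteK : Family → Set
  CompleteK 𝒬 = (∀ q → 𝒬 q → IsClique q) ×
                (∀ q q' → 𝒬 q → 𝒬 q' → q ≢ q' → ∃ λ v → v ∈ q ∩ q')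

  _⊆F_ : Family → Family → Set
  𝒬 ⊆F 𝒬' = ∀ q → 𝒬 q → 𝒬' q

  IsCliqueK : Family → Set₁
  IsCliqueK 𝒬 = CompleteK 𝒬 × (∀ 𝒬' → CompleteK 𝒬' → 𝒬 ⊆F 𝒬' → 𝒬' ⊆F 𝒬)

  star : Fin n → Family
  star x q = IsClique q × x ∈ q

  IsNormal : Fin n → Set₁
  IsNormal x = IsCliqueK (star x)

  InducesC4 : Subset n → Set
  InducesC4 S = Σ (Fin n) λ a → Σ (Fin n) λ b → Σ (Fin n) λ c → Σ (Fin n) λ d →
    (a ≢ b × a ≢ c × a ≢ d × b ≢ c × b ≢ d × c ≢ d) ×
    (∀ v → v ∈ S → v ≡ a ⊎ v ≡ b ⊎ v ≡ c ⊎ v ≡ d) ×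
    (a ∈ S × b ∈ S × c ∈ S × d ∈ S) ×
    (Adj a b × Adj b c × Adj c d × Adj d a) ×
    (¬ Adj a c × ¬ Adj b d)

-- The octahedron K_{2,2,2} on Fin 6: parts {0,1},{2,3},{4,5}.
octE : Fin 6 → Fin 6 → Bool
octE i j = not ((toℕ i / 2) ≡ᵇ (toℕ j / 2))

IsOctahedron : ∀ {n} → Graph n → Set
IsOctahedron {n} G = Σ (Fin n ↔ Fin 6) λ f →
  ∀ u v → E G u v ≡ octE (Inverse.to f u) (Inverse.to f v)

-- Write T = xyz and T' = xyw.  Maximality of T forbids z ~ w.  Let a be the apex of the second
-- triangle on the edge xz and b that on xw: x already has the four neighbours y, z, a, w, so degree 4
-- forces b = a, and N(x) is the induced 4-cycle y z a w; symmetrically N(y) is the 4-cycle x z c w.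
-- If a ~ c, the non-adjacent x and c are both joined to the whole cycle y z a w, and with degree 4
-- and connectivity G is the octahedron; hence a ≁ c and N(z) = {x, y, a, c}.  A vertex whose
-- neighbourhood is an induced 4-cycle is normal, because a clique avoiding it would have to contain
-- an edge of each of its four triangles.  The triangle xza is not inner (no second triangle contains
-- za), and neither is yzc, so T' is the only inner ear of T.  Finally the clique T' meets every
-- clique through z, so z* is not maximal in K(G).

module Submission where

open import Defs hiding (sym)
open import Algebra.Bundles using (CommutativeMonoid)
open import Data.Bool as Bool using (T; true; false)
open import Data.Bool.Properties using (T-≡; ¬-not)
open import Data.Empty using (⊥)
open import Data.Fin using (Fin; zero; suc)
open import Data.Fin.Properties using (_≟_; any?; all?)
open import Data.Fin.Subset using (Subset; _∈_; _∉_; _⊆_; _∩_; _∪_; ⁅_⁆; ∣_∣; Nonempty; outside; inside)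
  renaming (⊥ to ∅)
open import Data.Fin.Subset.Properties
  using (_∈?_; ⊆-antisym; x∈p∪q⁺; x∈p∪q⁻; x∈⁅x⁆; x∈⁅y⁆⇒x≡y; x∈p∩q⁺; x∈p∩q⁻; p⊆p∪q; ∪-comm; ∪-commutativeMonoid;
         ∣p∣≤∣x∷p∣; ∣⁅x⁆∣≡1; ∣⊥∣≡0; p⊆q⇒∣p∣≤∣q∣; x∈p∧x≢y⇒x∈p-y; x∈p⇒∣p-x∣<∣p∣)
open import Data.List using (List; []; _∷_; length)
open import Data.List.Relation.Unary.All as All using (All; []; _∷_)
open import Data.List.Relation.Unary.AllPairs using ([]; _∷_)
open import Data.List.Relation.Unary.Unique.Propositional using (Unique)
open import Data.Nat using (ℕ; _+_; _≤_; _<_; z≤n; s≤s)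
open import Data.Nat.Properties using (≤-trans; +-suc; +-monoʳ-≤; ≤-antisym; <⇒≱)
open import Data.Product using (∃; ∃₂; _×_; _,_; proj₁; proj₂; swap)
open import Data.Sum using (_⊎_; inj₁; inj₂; map₂)
open import Data.Vec using ([]; _∷_)
open import Data.Vec.Properties using (lookup∘tabulate; []=⇒lookup; lookup⇒[]=)
open import Function using (_∘_)
open import Function.Bundles using (Equivalence; mk↔ₛ′)
open import Relation.Nullary using (¬_; ¬?; yes; no; contradiction; _×-dec_)
open import Relation.Nullary.Decidable using (toWitness; _→-dec_; _⊎-dec_)
open import Relation.Binary.PropositionalEquality using (_≡_; _≢_; refl; sym; trans; cong; cong₂; subst; subst₂)

-- Small subsets of Fin n

private variable
  n : ℕ
  p q : Subset n
  u v w x y z : Fin n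

x∈⁅y⁆∪⁅z⁆⁺ : x ≡ y ⊎ x ≡ z → x ∈ ⁅ y ⁆ ∪ ⁅ z ⁆
x∈⁅y⁆∪⁅z⁆⁺ (inj₁ refl) = x∈p∪q⁺ (inj₁ (x∈⁅x⁆ _))
x∈⁅y⁆∪⁅z⁆⁺ (inj₂ refl) = x∈p∪q⁺ (inj₂ (x∈⁅x⁆ _))

x∈⁅y⁆∪⁅z⁆⁻ : ∀ y z → x ∈ ⁅ y ⁆ ∪ ⁅ z ⁆ → x ≡ y ⊎ x ≡ z
x∈⁅y⁆∪⁅z⁆⁻ y z x∈ with x∈p∪q⁻ ⁅ y ⁆ ⁅ z ⁆ x∈
... | inj₁ x∈y = inj₁ (x∈⁅y⁆⇒x≡y y x∈y)
... | inj₂ x∈z = inj₂ (x∈⁅y⁆⇒x≡y z x∈z)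

x∈⁅y⁆∪⁅z⁆∪⁅w⁆⁺ : x ≡ y ⊎ x ≡ z ⊎ x ≡ w → x ∈ ⁅ y ⁆ ∪ ⁅ z ⁆ ∪ ⁅ w ⁆
x∈⁅y⁆∪⁅z⁆∪⁅w⁆⁺ (inj₁ refl) = x∈p∪q⁺ (inj₁ (x∈⁅x⁆ _))
x∈⁅y⁆∪⁅z⁆∪⁅w⁆⁺ (inj₂ x∈zw) = x∈p∪q⁺ (inj₂ (x∈⁅y⁆∪⁅z⁆⁺ x∈zw))

x∈⁅y⁆∪⁅z⁆∪⁅w⁆⁻ : ∀ y z w → x ∈ ⁅ y ⁆ ∪ ⁅ z ⁆ ∪ ⁅ w ⁆ → x ≡ y ⊎ x ≡ z ⊎ x ≡ w
x∈⁅y⁆∪⁅z⁆∪⁅w⁆⁻ y z w x∈ with x∈p∪q⁻ ⁅ y ⁆ (⁅ z ⁆ ∪ ⁅ w ⁆) x∈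
... | inj₁ x∈y  = inj₁ (x∈⁅y⁆⇒x≡y y x∈y)
... | inj₂ x∈zw = inj₂ (x∈⁅y⁆∪⁅z⁆⁻ z w x∈zw)

⁅x⁆∪⁅y⁆∪⁅z⁆≡⁅y⁆∪⁅x⁆∪⁅z⁆ : ∀ (x y z : Fin n) → ⁅ x ⁆ ∪ ⁅ y ⁆ ∪ ⁅ z ⁆ ≡ ⁅ y ⁆ ∪ ⁅ x ⁆ ∪ ⁅ z ⁆
⁅x⁆∪⁅y⁆∪⁅z⁆≡⁅y⁆∪⁅x⁆∪⁅z⁆ {n} x y z = x∙yz≈y∙xz ⁅ x ⁆ ⁅ y ⁆ ⁅ z ⁆
  where open import Algebra.Properties.CommutativeSemigroup
          (CommutativeMonoid.commutativeSemigroup (∪-commutativeMonoid n)) using (x∙yz≈y∙xz)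

⁅x⁆∪⁅y⁆⊆p : x ∈ p → y ∈ p → ⁅ x ⁆ ∪ ⁅ y ⁆ ⊆ p
⁅x⁆∪⁅y⁆⊆p {x = x} {y = y} x∈p y∈p u∈ with x∈⁅y⁆∪⁅z⁆⁻ x y u∈
... | inj₁ refl = x∈p
... | inj₂ refl = y∈p

∣p∪q∣≤∣p∣+∣q∣ : ∀ (p q : Subset n) → ∣ p ∪ q ∣ ≤ ∣ p ∣ + ∣ q ∣
∣p∪q∣≤∣p∣+∣q∣ []            []      = z≤n
∣p∪q∣≤∣p∣+∣q∣ (inside  ∷ p) (s ∷ q) = s≤s (≤-trans (∣p∪q∣≤∣p∣+∣q∣ p q) (+-monoʳ-≤ ∣ p ∣ (∣p∣≤∣x∷p∣ s q)))
∣p∪q∣≤∣p∣+∣q∣ (outside ∷ p) (inside  ∷ q) rewrite +-suc ∣ p ∣ ∣ q ∣ = s≤s (∣p∪q∣≤∣p∣+∣q∣ p q)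
∣p∪q∣≤∣p∣+∣q∣ (outside ∷ p) (outside ∷ q) = ∣p∪q∣≤∣p∣+∣q∣ p q

∣⁅x⁆∪⁅y⁆∣≤2 : ∀ (x y : Fin n) → ∣ ⁅ x ⁆ ∪ ⁅ y ⁆ ∣ ≤ 2
∣⁅x⁆∪⁅y⁆∣≤2 x y = subst (∣ ⁅ x ⁆ ∪ ⁅ y ⁆ ∣ ≤_) (cong₂ _+_ (∣⁅x⁆∣≡1 x) (∣⁅x⁆∣≡1 y)) (∣p∪q∣≤∣p∣+∣q∣ ⁅ x ⁆ ⁅ y ⁆)

length≤∣p∣ : ∀ {l : List (Fin n)} → Unique l → All (_∈ p) l → length l ≤ ∣ p ∣
length≤∣p∣ [] [] = z≤n
length≤∣p∣ (v∉l ∷ unique) (v∈p ∷ l⊆p) =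
  ≤-trans (s≤s (length≤∣p∣ unique (All.zipWith (λ (v≢u , u∈p) → x∈p∧x≢y⇒x∈p-y u∈p (v≢u ∘ sym)) (v∉l , l⊆p))))
          (x∈p⇒∣p-x∣<∣p∣ v∈p)

∣⁅x⁆∪⁅y⁆∣≡2 : x ≢ y → ∣ ⁅ x ⁆ ∪ ⁅ y ⁆ ∣ ≡ 2
∣⁅x⁆∪⁅y⁆∣≡2 {x = x} {y} x≢y = ≤-antisym (∣⁅x⁆∪⁅y⁆∣≤2 x y)
  (length≤∣p∣ ((x≢y ∷ []) ∷ [] ∷ []) (x∈⁅y⁆∪⁅z⁆⁺ (inj₁ refl) ∷ x∈⁅y⁆∪⁅z⁆⁺ (inj₂ refl) ∷ []))

∣q∣<∣p∣⇒∃∉ : ∀ (p q : Subset n) → ∣ q ∣ < ∣ p ∣ → ∃ λ u → u ∈ p × u ∉ q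
∣q∣<∣p∣⇒∃∉ p q ∣q∣<∣p∣ with any? (λ u → (u ∈? p) ×-dec ¬? (u ∈? q))
... | yes witness = witness
... | no ∄ = contradiction (p⊆q⇒∣p∣≤∣q∣ p⊆q) (<⇒≱ ∣q∣<∣p∣)
  where
  p⊆q : p ⊆ q
  p⊆q {u} u∈p with u ∈? q
  ... | yes u∈q = u∈q
  ... | no u∉q = contradiction (u , u∈p , u∉q) ∄

2≤∣p∣⇒∃₂ : 2 ≤ ∣ p ∣ → ∃₂ λ u v → u ≢ v × u ∈ p × v ∈ p
2≤∣p∣⇒∃₂ {n} {p} 2≤∣p∣
  with u , u∈p , _ ← ∣q∣<∣p∣⇒∃∉ p ∅ (subst (_< ∣ p ∣) (sym (∣⊥∣≡0 n)) (≤-trans (s≤s z≤n) 2≤∣p∣))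
  with v , v∈p , v∉u ← ∣q∣<∣p∣⇒∃∉ p ⁅ u ⁆ (subst (_< ∣ p ∣) (sym (∣⁅x⁆∣≡1 u)) 2≤∣p∣)
  = u , v , (λ u≡v → v∉u (subst (_∈ ⁅ u ⁆) u≡v (x∈⁅x⁆ u))) , u∈p , v∈p

∣p∣≡3⇒≡⁅x⁆∪⁅y⁆∪⁅_⁆ : ∣ p ∣ ≡ 3 → x ∈ p → y ∈ p → x ≢ y →
                       ∃ λ z → z ≢ x × z ≢ y × p ≡ ⁅ x ⁆ ∪ ⁅ y ⁆ ∪ ⁅ z ⁆
∣p∣≡3⇒≡⁅x⁆∪⁅y⁆∪⁅_⁆ {p = p} {x} {y} ∣p∣≡3 x∈p y∈p x≢y
  with z , z∈p , z∉xy ← ∣q∣<∣p∣⇒∃∉ p (⁅ x ⁆ ∪ ⁅ y ⁆) (subst (_ <_) (sym ∣p∣≡3) (s≤s (∣⁅x⁆∪⁅y⁆∣≤2 x y)))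
  = z , z≢x , z≢y , ⊆-antisym p⊆xyz xyz⊆p
  where
  z≢x : z ≢ x
  z≢x z≡x = z∉xy (x∈⁅y⁆∪⁅z⁆⁺ (inj₁ z≡x))
  z≢y : z ≢ y
  z≢y z≡y = z∉xy (x∈⁅y⁆∪⁅z⁆⁺ (inj₂ z≡y))
  xyz⊆p : ⁅ x ⁆ ∪ ⁅ y ⁆ ∪ ⁅ z ⁆ ⊆ p
  xyz⊆p u∈ with x∈⁅y⁆∪⁅z⁆∪⁅w⁆⁻ x y z u∈
  ... | inj₁ refl        = x∈p
  ... | inj₂ (inj₁ refl) = y∈p
  ... | inj₂ (inj₂ refl) = z∈p
  p⊆xyz : p ⊆ ⁅ x ⁆ ∪ ⁅ y ⁆ ∪ ⁅ z ⁆
  p⊆xyz {u} u∈p with u ∈? ⁅ x ⁆ ∪ ⁅ y ⁆ ∪ ⁅ z ⁆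
  ... | yes u∈xyz = u∈xyz
  ... | no u∉xyz = contradiction (subst (4 ≤_) ∣p∣≡3 (length≤∣p∣ unique (x∈p ∷ y∈p ∷ z∈p ∷ u∈p ∷ []))) λ { (s≤s (s≤s (s≤s ()))) }
    where
    u≢ : ∀ {v} → v ≡ x ⊎ v ≡ y ⊎ v ≡ z → v ≢ u
    u≢ v≡ refl = u∉xyz (x∈⁅y⁆∪⁅z⁆∪⁅w⁆⁺ v≡)
    unique : Unique (x ∷ y ∷ z ∷ u ∷ [])
    unique = (x≢y ∷ z≢x ∘ sym ∷ u≢ (inj₁ refl) ∷ [])
           ∷ (z≢y ∘ sym ∷ u≢ (inj₂ (inj₁ refl)) ∷ [])
           ∷ (u≢ (inj₂ (inj₂ refl)) ∷ []) ∷ [] ∷ []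

∣⁅x⁆∪⁅y⁆∪⁅z⁆∣≡3⇒distinct : ∣ ⁅ x ⁆ ∪ ⁅ y ⁆ ∪ ⁅ z ⁆ ∣ ≡ 3 → x ≢ y × x ≢ z × y ≢ z
∣⁅x⁆∪⁅y⁆∪⁅z⁆∣≡3⇒distinct {x = x} {y} {z} ∣xyz∣≡3 =
  (λ x≡y → covered λ { (inj₁ w≡x) → inj₁ (trans w≡x x≡y) ; (inj₂ w≡yz) → w≡yz }) ,
  (λ x≡z → covered λ { (inj₁ w≡x) → inj₂ (trans w≡x x≡z) ; (inj₂ w≡yz) → w≡yz }) ,
  (λ y≡z → covered {v = y} λ { (inj₁ w≡x) → inj₁ w≡x ; (inj₂ (inj₁ w≡y)) → inj₂ w≡y
                             ; (inj₂ (inj₂ w≡z)) → inj₂ (trans w≡z (sym y≡z)) })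
  where
  covered : ∀ {u v} → (∀ {w} → w ≡ x ⊎ w ≡ y ⊎ w ≡ z → w ≡ u ⊎ w ≡ v) → ⊥
  covered {u} {v} cover = contradiction
    (subst (_≤ 2) ∣xyz∣≡3 (≤-trans (p⊆q⇒∣p∣≤∣q∣ λ w∈ → x∈⁅y⁆∪⁅z⁆⁺ (cover (x∈⁅y⁆∪⁅z⁆∪⁅w⁆⁻ x y z w∈))) (∣⁅x⁆∪⁅y⁆∣≤2 u v)))
    λ { (s≤s (s≤s ())) }

two-of-three : 2 ≤ ∣ q ∩ (⁅ x ⁆ ∪ ⁅ y ⁆ ∪ ⁅ z ⁆) ∣ → (x ∈ q × y ∈ q) ⊎ (x ∈ q × z ∈ q) ⊎ (y ∈ q × z ∈ q)
two-of-three {q = q} {x} {y} {z} 2≤∣q∩xyz∣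
  with u , v , u≢v , u∈ , v∈ ← 2≤∣p∣⇒∃₂ 2≤∣q∩xyz∣
  with u∈q , u∈xyz ← x∈p∩q⁻ q _ u∈ | v∈q , v∈xyz ← x∈p∩q⁻ q _ v∈
  with x∈⁅y⁆∪⁅z⁆∪⁅w⁆⁻ x y z u∈xyz | x∈⁅y⁆∪⁅z⁆∪⁅w⁆⁻ x y z v∈xyz
... | inj₁ refl        | inj₁ refl        = contradiction refl u≢v
... | inj₁ refl        | inj₂ (inj₁ refl) = inj₁ (u∈q , v∈q)
... | inj₁ refl        | inj₂ (inj₂ refl) = inj₂ (inj₁ (u∈q , v∈q))
... | inj₂ (inj₁ refl) | inj₁ refl        = inj₁ (v∈q , u∈q)
... | inj₂ (inj₁ refl) | inj₂ (inj₁ refl) = contradiction refl u≢v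
... | inj₂ (inj₁ refl) | inj₂ (inj₂ refl) = inj₂ (inj₂ (u∈q , v∈q))
... | inj₂ (inj₂ refl) | inj₁ refl        = inj₂ (inj₁ (v∈q , u∈q))
... | inj₂ (inj₂ refl) | inj₂ (inj₁ refl) = inj₂ (inj₂ (v∈q , u∈q))
... | inj₂ (inj₂ refl) | inj₂ (inj₂ refl) = contradiction refl u≢v

∣p∣≡∣q∣≡3∧p∩q≡⁅x⁆∪⁅y⁆⇒ : ∣ p ∣ ≡ 3 → ∣ q ∣ ≡ 3 → x ≢ y → p ∩ q ≡ ⁅ x ⁆ ∪ ⁅ y ⁆ →
  ∃₂ λ z w → z ≢ w × p ≡ ⁅ x ⁆ ∪ ⁅ y ⁆ ∪ ⁅ z ⁆ × q ≡ ⁅ x ⁆ ∪ ⁅ y ⁆ ∪ ⁅ w ⁆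
∣p∣≡∣q∣≡3∧p∩q≡⁅x⁆∪⁅y⁆⇒ {p = p} {q} {x} {y} ∣p∣≡3 ∣q∣≡3 x≢y p∩q≡xy =
  combine (∣p∣≡3⇒≡⁅x⁆∪⁅y⁆∪⁅_⁆ ∣p∣≡3 (∈p (inj₁ refl)) (∈p (inj₂ refl)) x≢y)
          (∣p∣≡3⇒≡⁅x⁆∪⁅y⁆∪⁅_⁆ ∣q∣≡3 (∈q (inj₁ refl)) (∈q (inj₂ refl)) x≢y)
  where
  ∈p∩q : ∀ {u} → u ≡ x ⊎ u ≡ y → u ∈ p × u ∈ q
  ∈p∩q {u} u≡ = x∈p∩q⁻ p q (subst (u ∈_) (sym p∩q≡xy) (x∈⁅y⁆∪⁅z⁆⁺ u≡))
  ∈p : ∀ {u} → u ≡ x ⊎ u ≡ y → u ∈ p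
  ∈p = proj₁ ∘ ∈p∩q
  ∈q : ∀ {u} → u ≡ x ⊎ u ≡ y → u ∈ q
  ∈q = proj₂ ∘ ∈p∩q
  combine : (∃ λ z → z ≢ x × z ≢ y × p ≡ ⁅ x ⁆ ∪ ⁅ y ⁆ ∪ ⁅ z ⁆) → (∃ λ w → w ≢ x × w ≢ y × q ≡ ⁅ x ⁆ ∪ ⁅ y ⁆ ∪ ⁅ w ⁆) →
            ∃₂ λ z w → z ≢ w × p ≡ ⁅ x ⁆ ∪ ⁅ y ⁆ ∪ ⁅ z ⁆ × q ≡ ⁅ x ⁆ ∪ ⁅ y ⁆ ∪ ⁅ w ⁆
  combine (z , z≢x , z≢y , refl) (w , _ , _ , refl) = z , w , z≢w , refl , refl
    where
    z≢w : z ≢ w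
    z≢w refl with x∈⁅y⁆∪⁅z⁆⁻ x y (subst (z ∈_) p∩q≡xy (x∈p∩q⁺ (z∈ , z∈)))
      where z∈ = x∈⁅y⁆∪⁅z⁆∪⁅w⁆⁺ (inj₂ (inj₂ refl))
    ... | inj₁ z≡x = z≢x z≡x
    ... | inj₂ z≡y = z≢y z≡y

-- The octahedron on Fin 6

pattern i₀ = zero
pattern i₁ = suc i₀
pattern i₂ = suc i₁
pattern i₃ = suc i₂
pattern i₄ = suc i₃
pattern i₅ = suc i₄

antipode : Fin 6 → Fin 6
antipode i₀ = i₁
antipode i₁ = i₀
antipode i₂ = i₃
antipode i₃ = i₂
antipode i₄ = i₅
antipode i₅ = i₄

octE≡false⇒antipodal : ∀ i j → octE i j ≡ false → i ≡ j ⊎ j ≡ antipode i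
octE≡false⇒antipodal =
  toWitness {a? = all? λ i → all? λ j → (octE i j Bool.≟ false) →-dec (i ≟ j ⊎-dec j ≟ antipode i)} _

module GraphProperties {n : ℕ} (G : Graph n) where

  private variable
    a b c d : Fin n
    s : Subset n

  Adj-sym : Adj G u v → Adj G v u
  Adj-sym {u} {v} = subst T (Graph.sym G u v)

  Adj-irrefl : ¬ Adj G u u
  Adj-irrefl {u} = subst T (irref G u)

  Adj⇒≢ : Adj G u v → u ≢ v
  Adj⇒≢ u~v refl = Adj-irrefl u~v

  Adj⇒∈N : Adj G x v → v ∈ N G x
  Adj⇒∈N {x} {v} x~v = lookup⇒[]= v (N G x) (trans (lookup∘tabulate (E G x) v) (Equivalence.to T-≡ x~v))

  ∈N⇒Adj : v ∈ N G x → Adj G x v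
  ∈N⇒Adj {v} {x} v∈N = Equivalence.from T-≡ (trans (sym (lookup∘tabulate (E G x) v)) ([]=⇒lookup v∈N))

  Adj⇒E≡true : Adj G u v → E G u v ≡ true
  Adj⇒E≡true = Equivalence.to T-≡

  ¬Adj⇒E≡false : ¬ Adj G u v → E G u v ≡ false
  ¬Adj⇒E≡false u≁v = ¬-not (u≁v ∘ Equivalence.from T-≡)

  Complete-∪⁅⁆ : Complete G s → (∀ u → u ∈ s → u ≢ v → Adj G u v) → Complete G (s ∪ ⁅ v ⁆)
  Complete-∪⁅⁆ {s} {v} complete u~v u w u∈ w∈ u≢w
    with x∈p∪q⁻ s ⁅ v ⁆ u∈ | x∈p∪q⁻ s ⁅ v ⁆ w∈
  ... | inj₁ u∈s | inj₁ w∈s = complete u w u∈s w∈s u≢w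
  ... | inj₁ u∈s | inj₂ w∈v with refl ← x∈⁅y⁆⇒x≡y v w∈v = u~v u u∈s u≢w
  ... | inj₂ u∈v | inj₁ w∈s with refl ← x∈⁅y⁆⇒x≡y v u∈v = Adj-sym (u~v w w∈s (u≢w ∘ sym))
  ... | inj₂ u∈v | inj₂ w∈v = contradiction (trans (x∈⁅y⁆⇒x≡y v u∈v) (sym (x∈⁅y⁆⇒x≡y v w∈v))) u≢w

  clique-absorbs : IsClique G s → (∀ u → u ∈ s → u ≢ v → Adj G u v) → v ∈ s
  clique-absorbs {s} {v} (complete , maximal) u~v =
    maximal (s ∪ ⁅ v ⁆) (Complete-∪⁅⁆ complete u~v) (p⊆p∪q ⁅ v ⁆) (x∈p∪q⁺ (inj₂ (x∈⁅x⁆ v)))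

  triangle-clique⇒no-common-neighbour : IsClique G (⁅ a ⁆ ∪ ⁅ b ⁆ ∪ ⁅ c ⁆) →
    Adj G a v → Adj G b v → Adj G c v → ⊥
  triangle-clique⇒no-common-neighbour {a} {b} {c} {v} clique a~v b~v c~v
    with x∈⁅y⁆∪⁅z⁆∪⁅w⁆⁻ a b c (clique-absorbs clique adjacent)
    where
    adjacent : ∀ u → u ∈ ⁅ a ⁆ ∪ ⁅ b ⁆ ∪ ⁅ c ⁆ → u ≢ v → Adj G u v
    adjacent u u∈ _ with x∈⁅y⁆∪⁅z⁆∪⁅w⁆⁻ a b c u∈
    ... | inj₁ refl        = a~v
    ... | inj₂ (inj₁ refl) = b~v
    ... | inj₂ (inj₂ refl) = c~v
  ... | inj₁ refl        = Adj-irrefl a~v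
  ... | inj₂ (inj₁ refl) = Adj-irrefl b~v
  ... | inj₂ (inj₂ refl) = Adj-irrefl c~v

  no-common-neighbour⇒triangle-clique : Adj G a b → Adj G a c → Adj G b c →
    (∀ {v} → Adj G a v → Adj G b v → Adj G c v → ⊥) → IsClique G (⁅ a ⁆ ∪ ⁅ b ⁆ ∪ ⁅ c ⁆)
  no-common-neighbour⇒triangle-clique {a} {b} {c} a~b a~c b~c no-common = complete , maximal
    where
    complete : Complete G (⁅ a ⁆ ∪ ⁅ b ⁆ ∪ ⁅ c ⁆)
    complete u v u∈ v∈ u≢v with x∈⁅y⁆∪⁅z⁆∪⁅w⁆⁻ a b c u∈ | x∈⁅y⁆∪⁅z⁆∪⁅w⁆⁻ a b c v∈
    ... | inj₁ refl        | inj₁ refl        = contradiction refl u≢v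
    ... | inj₁ refl        | inj₂ (inj₁ refl) = a~b
    ... | inj₁ refl        | inj₂ (inj₂ refl) = a~c
    ... | inj₂ (inj₁ refl) | inj₁ refl        = Adj-sym a~b
    ... | inj₂ (inj₁ refl) | inj₂ (inj₁ refl) = contradiction refl u≢v
    ... | inj₂ (inj₁ refl) | inj₂ (inj₂ refl) = b~c
    ... | inj₂ (inj₂ refl) | inj₁ refl        = Adj-sym a~c
    ... | inj₂ (inj₂ refl) | inj₂ (inj₁ refl) = Adj-sym b~c
    ... | inj₂ (inj₂ refl) | inj₂ (inj₂ refl) = contradiction refl u≢v
    maximal : ∀ s → Complete G s → ⁅ a ⁆ ∪ ⁅ b ⁆ ∪ ⁅ c ⁆ ⊆ s → s ⊆ ⁅ a ⁆ ∪ ⁅ b ⁆ ∪ ⁅ c ⁆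
    maximal s complete-s abc⊆s {v} v∈s with v ∈? ⁅ a ⁆ ∪ ⁅ b ⁆ ∪ ⁅ c ⁆
    ... | yes v∈abc = v∈abc
    ... | no v∉abc = contradiction (no-common (adjacent (inj₁ refl)) (adjacent (inj₂ (inj₁ refl))) (adjacent (inj₂ (inj₂ refl)))) λ ()
      where
      adjacent : ∀ {u} → u ≡ a ⊎ u ≡ b ⊎ u ≡ c → Adj G u v
      adjacent u≡ = complete-s _ v (abc⊆s (x∈⁅y⁆∪⁅z⁆∪⁅w⁆⁺ u≡)) v∈s
                      λ { refl → v∉abc (x∈⁅y⁆∪⁅z⁆∪⁅w⁆⁺ u≡) }

  triangle-edges : ∀ {x y z} → IsTriangle G (⁅ x ⁆ ∪ ⁅ y ⁆ ∪ ⁅ z ⁆) → Adj G x y × Adj G x z × Adj G y z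
  triangle-edges {x} {y} {z} (complete , ∣xyz∣≡3) with x≢y , x≢z , y≢z ← ∣⁅x⁆∪⁅y⁆∪⁅z⁆∣≡3⇒distinct ∣xyz∣≡3 =
      complete x y (∈xyz (inj₁ refl)) (∈xyz (inj₂ (inj₁ refl))) x≢y
    , complete x z (∈xyz (inj₁ refl)) (∈xyz (inj₂ (inj₂ refl))) x≢z
    , complete y z (∈xyz (inj₂ (inj₁ refl))) (∈xyz (inj₂ (inj₂ refl))) y≢z
    where ∈xyz = x∈⁅y⁆∪⁅z⁆∪⁅w⁆⁺

  inner-edge-apex : IsInnerTriangle G s → u ∈ s → v ∈ s → u ≢ v → ∃ λ b → b ∉ s × Adj G u b × Adj G v b
  inner-edge-apex {s} {u} {v} (_ , _ , extend) u∈s v∈s u≢v =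
    apex (extend (⁅ u ⁆ ∪ ⁅ v ⁆) (⁅x⁆∪⁅y⁆⊆p u∈s v∈s , ∣⁅x⁆∪⁅y⁆∣≡2 u≢v))
    where
    apex : (∃ λ s' → IsTriangle G s' × s' ≢ s × s ∩ s' ≡ ⁅ u ⁆ ∪ ⁅ v ⁆) → ∃ λ b → b ∉ s × Adj G u b × Adj G v b
    apex (s' , (complete' , ∣s'∣≡3) , _ , s∩s'≡uv) =
      third (∣p∣≡3⇒≡⁅x⁆∪⁅y⁆∪⁅_⁆ ∣s'∣≡3 (∈s' (inj₁ refl)) (∈s' (inj₂ refl)) u≢v)
      where
      ∈s' : ∀ {w} → w ≡ u ⊎ w ≡ v → w ∈ s'
      ∈s' {w} w≡ = proj₂ (x∈p∩q⁻ s s' (subst (w ∈_) (sym s∩s'≡uv) (x∈⁅y⁆∪⁅z⁆⁺ w≡)))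
      third : (∃ λ b → b ≢ u × b ≢ v × s' ≡ ⁅ u ⁆ ∪ ⁅ v ⁆ ∪ ⁅ b ⁆) → ∃ λ b → b ∉ s × Adj G u b × Adj G v b
      third (b , b≢u , b≢v , s'≡uvb) =
        b , b∉s , complete' u b (∈s' (inj₁ refl)) b∈s' (b≢u ∘ sym) , complete' v b (∈s' (inj₂ refl)) b∈s' (b≢v ∘ sym)
        where
        b∈s' : b ∈ s'
        b∈s' = subst (b ∈_) (sym s'≡uvb) (x∈⁅y⁆∪⁅z⁆∪⁅w⁆⁺ (inj₂ (inj₂ refl)))
        b∉s : b ∉ s
        b∉s b∈s with x∈⁅y⁆∪⁅z⁆⁻ u v (subst (b ∈_) s∩s'≡uv (x∈p∩q⁺ (b∈s , b∈s')))
        ... | inj₁ b≡u = b≢u b≡u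
        ... | inj₂ b≡v = b≢v b≡v

  MeetsStar : Fin n → Subset n → Set
  MeetsStar x q = ∀ q' → star G x q' → Nonempty (q ∩ q')

  no-clique-meets-star⇒normal : (∀ q → IsClique G q → x ∉ q → ¬ MeetsStar x q) → IsNormal G x
  no-clique-meets-star⇒normal {x} no-meeting = ((λ _ → proj₁) , λ _ _ (_ , x∈q) (_ , x∈q') _ → x , x∈p∩q⁺ (x∈q , x∈q')) , maximal
    where
    maximal : ∀ 𝒬 → CompleteK G 𝒬 → (G ⊆F star G x) 𝒬 → (G ⊆F 𝒬) (star G x)
    maximal 𝒬 (cliques , meet) star⊆𝒬 q q∈𝒬 with x ∈? q
    ... | yes x∈q = cliques q q∈𝒬 , x∈q
    ... | no x∉q = contradiction meets (no-meeting q (cliques q q∈𝒬) x∉q)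
      where
      meets : MeetsStar x q
      meets q' x∈q'@(_ , x∈) = meet q q' q∈𝒬 (star⊆𝒬 q' x∈q') λ { refl → x∉q x∈ }

  clique-meets-star⇒¬normal : IsClique G q → x ∉ q → MeetsStar x q → ¬ IsNormal G x
  clique-meets-star⇒¬normal {q} {x} q-clique x∉q meets (_ , maximal) =
    x∉q (proj₂ (maximal 𝒬 (cliques , meet) (λ _ → inj₁) q (inj₂ refl)))
    where
    𝒬 : Family G
    𝒬 q' = star G x q' ⊎ q' ≡ q
    cliques : ∀ q' → 𝒬 q' → IsClique G q'
    cliques q' (inj₁ (q'-clique , _)) = q'-clique
    cliques q' (inj₂ refl) = q-clique
    meet : ∀ q₁ q₂ → 𝒬 q₁ → 𝒬 q₂ → q₁ ≢ q₂ → Nonempty (q₁ ∩ q₂)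
    meet q₁ q₂ (inj₁ (_ , x∈q₁)) (inj₁ (_ , x∈q₂)) _ = x , x∈p∩q⁺ (x∈q₁ , x∈q₂)
    meet q₁ q₂ (inj₁ q₁∈x*) (inj₂ refl) _ with u , u∈ ← meets q₁ q₁∈x* =
      u , x∈p∩q⁺ (swap (x∈p∩q⁻ q q₁ u∈))
    meet q₁ q₂ (inj₂ refl) (inj₁ q₂∈x*) _ = meets q₂ q₂∈x*
    meet q₁ q₂ (inj₂ refl) (inj₂ refl) q≢q = contradiction refl q≢q

  record Cycle4 (a b c d : Fin n) : Set where
    field
      a~b : Adj G a b
      b~c : Adj G b c
      c~d : Adj G c d
      d~a : Adj G d a
      a≁c : ¬ Adj G a c
      b≁d : ¬ Adj G b d
      a≢c : a ≢ c
      b≢d : b ≢ d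

    unique : Unique (a ∷ b ∷ c ∷ d ∷ [])
    unique = (Adj⇒≢ a~b ∷ a≢c ∷ (Adj⇒≢ d~a ∘ sym) ∷ []) ∷ (Adj⇒≢ b~c ∷ b≢d ∷ []) ∷ (Adj⇒≢ c~d ∷ []) ∷ [] ∷ []

  rotate : Cycle4 a b c d → Cycle4 b c d a
  rotate C = record
    { a~b = b~c ; b~c = c~d ; c~d = d~a ; d~a = a~b
    ; a≁c = b≁d ; b≁d = a≁c ∘ Adj-sym ; a≢c = b≢d ; b≢d = a≢c ∘ sym }
    where open Cycle4 C

  record C4Neighbourhood (x a b c d : Fin n) : Set where
    field
      cycle : Cycle4 a b c d
      x~a : Adj G x a
      x~b : Adj G x b
      x~c : Adj G x c
      x~d : Adj G x d
      neighbours : ∀ {v} → Adj G x v → v ≡ a ⊎ v ≡ b ⊎ v ≡ c ⊎ v ≡ d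
    open Cycle4 cycle public

  rotate-C4Neighbourhood : C4Neighbourhood x a b c d → C4Neighbourhood x b c d a
  rotate-C4Neighbourhood C = record
    { cycle = rotate cycle ; x~a = x~b ; x~b = x~c ; x~c = x~d ; x~d = x~a ; neighbours = shift ∘ neighbours }
    where
    open C4Neighbourhood C
    shift : v ≡ a ⊎ v ≡ b ⊎ v ≡ c ⊎ v ≡ d → v ≡ b ⊎ v ≡ c ⊎ v ≡ d ⊎ v ≡ a
    shift (inj₁ v≡a)               = inj₂ (inj₂ (inj₂ v≡a))
    shift (inj₂ (inj₁ v≡b))        = inj₁ v≡b
    shift (inj₂ (inj₂ (inj₁ v≡c))) = inj₂ (inj₁ v≡c)
    shift (inj₂ (inj₂ (inj₂ v≡d))) = inj₂ (inj₂ (inj₁ v≡d))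

  C4Neighbourhood⇒InducesC4 : C4Neighbourhood x a b c d → InducesC4 G (N G x)
  C4Neighbourhood⇒InducesC4 {a = a} {b} {c} {d} C =
    a , b , c , d
    , (Adj⇒≢ a~b , a≢c , Adj⇒≢ d~a ∘ sym , Adj⇒≢ b~c , b≢d , Adj⇒≢ c~d)
    , (λ v v∈N → neighbours (∈N⇒Adj v∈N))
    , (Adj⇒∈N x~a , Adj⇒∈N x~b , Adj⇒∈N x~c , Adj⇒∈N x~d)
    , (a~b , b~c , c~d , d~a)
    , (a≁c , b≁d)
    where open C4Neighbourhood C

  C4Neighbourhood⇒triangle-clique : C4Neighbourhood x a b c d → IsClique G (⁅ x ⁆ ∪ ⁅ a ⁆ ∪ ⁅ b ⁆)
  C4Neighbourhood⇒triangle-clique C = no-common-neighbour⇒triangle-clique x~a x~b a~b common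
    where
    open C4Neighbourhood C
    common : Adj G _ v → Adj G _ v → Adj G _ v → ⊥
    common x~v a~v b~v with neighbours x~v
    ... | inj₁ refl               = Adj-irrefl a~v
    ... | inj₂ (inj₁ refl)        = Adj-irrefl b~v
    ... | inj₂ (inj₂ (inj₁ refl)) = a≁c a~v
    ... | inj₂ (inj₂ (inj₂ refl)) = b≁d b~v

  C4Neighbourhood⇒normal : C4Neighbourhood x a b c d → IsNormal G x
  C4Neighbourhood⇒normal {x} {a} {b} {c} {d} C = no-clique-meets-star⇒normal no-meeting
    where
    open C4Neighbourhood C
    no-meeting : ∀ q → IsClique G q → x ∉ q → ¬ MeetsStar x q
    no-meeting q (q-complete , _) x∉q meets
      with side C | side C² | side (rotate-C4Neighbourhood C) | side (rotate-C4Neighbourhood C²)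
      where
      C² = rotate-C4Neighbourhood (rotate-C4Neighbourhood C)
      side : ∀ {u w y z} → C4Neighbourhood x u w y z → u ∈ q ⊎ w ∈ q
      side C' with v , v∈ ← meets _ (C4Neighbourhood⇒triangle-clique C' , x∈⁅y⁆∪⁅z⁆∪⁅w⁆⁺ (inj₁ refl))
              with v∈q , v∈xuw ← x∈p∩q⁻ q _ v∈
              with x∈⁅y⁆∪⁅z⁆∪⁅w⁆⁻ _ _ _ v∈xuw
      ... | inj₁ refl        = contradiction v∈q x∉q
      ... | inj₂ (inj₁ refl) = inj₁ v∈q
      ... | inj₂ (inj₂ refl) = inj₂ v∈q
    ... | inj₁ a∈q | inj₁ c∈q | _ | _ = a≁c (q-complete a c a∈q c∈q a≢c)
    ... | inj₂ b∈q | inj₂ d∈q | _ | _ = b≁d (q-complete b d b∈q d∈q b≢d)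
    ... | inj₁ a∈q | inj₂ d∈q | inj₁ b∈q | _ = b≁d (q-complete b d b∈q d∈q b≢d)
    ... | inj₁ a∈q | inj₂ d∈q | inj₂ c∈q | _ = a≁c (q-complete a c a∈q c∈q a≢c)
    ... | inj₂ b∈q | inj₁ c∈q | _ | inj₁ d∈q = b≁d (q-complete b d b∈q d∈q b≢d)
    ... | inj₂ b∈q | inj₁ c∈q | _ | inj₂ a∈q = a≁c (q-complete a c a∈q c∈q a≢c)

  Adj-closed⇒universal : Connected G → (P : Fin n → Set) → (∀ {u v} → P u → Adj G u v → P v) → P u → ∀ v → P v
  Adj-closed⇒universal {u} connected P closed Pu v = along (connected u v)
    where
    along : ∀ {v} → Reach G u v → P v
    along here = Pu
    along (step r w~v) = closed (along r) w~v

  module MaxDegree4 (deg : MaxDegreeAtMost G 4) where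

    four-neighbours : Adj G x a → Adj G x b → Adj G x c → Adj G x d → Unique (a ∷ b ∷ c ∷ d ∷ []) →
                      Adj G x v → v ≡ a ⊎ v ≡ b ⊎ v ≡ c ⊎ v ≡ d
    four-neighbours {x} {a} {b} {c} {d} {v} x~a x~b x~c x~d
      ((a≢b ∷ a≢c ∷ a≢d ∷ []) ∷ (b≢c ∷ b≢d ∷ []) ∷ (c≢d ∷ []) ∷ [] ∷ []) x~v
      with v ≟ a | v ≟ b | v ≟ c | v ≟ d
    ... | yes v≡a | _ | _ | _ = inj₁ v≡a
    ... | _ | yes v≡b | _ | _ = inj₂ (inj₁ v≡b)
    ... | _ | _ | yes v≡c | _ = inj₂ (inj₂ (inj₁ v≡c))
    ... | _ | _ | _ | yes v≡d = inj₂ (inj₂ (inj₂ v≡d))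
    ... | no v≢a | no v≢b | no v≢c | no v≢d =
      contradiction (≤-trans (length≤∣p∣ unique (Adj⇒∈N x~a ∷ Adj⇒∈N x~b ∷ Adj⇒∈N x~c ∷ Adj⇒∈N x~d ∷ Adj⇒∈N x~v ∷ [])) (deg x))
                    λ { (s≤s (s≤s (s≤s (s≤s ())))) }
      where
      unique : Unique (a ∷ b ∷ c ∷ d ∷ v ∷ [])
      unique = (a≢b ∷ a≢c ∷ a≢d ∷ (v≢a ∘ sym) ∷ []) ∷ (b≢c ∷ b≢d ∷ (v≢b ∘ sym) ∷ [])
             ∷ (c≢d ∷ (v≢c ∘ sym) ∷ []) ∷ ((v≢d ∘ sym) ∷ []) ∷ [] ∷ []

    cone⇒C4Neighbourhood : Cycle4 a b c d → Adj G x a → Adj G x b → Adj G x c → Adj G x d → C4Neighbourhood x a b c d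
    cone⇒C4Neighbourhood cycle x~a x~b x~c x~d = record
      { cycle = cycle ; x~a = x~a ; x~b = x~b ; x~c = x~c ; x~d = x~d
      ; neighbours = four-neighbours x~a x~b x~c x~d (Cycle4.unique cycle) }

    -- Two non-adjacent vertices x, x' joined to all of an induced 4-cycle a b c d span an octahedron;
    -- all six vertices then have degree 4 already, so by connectivity there is nothing else.
    module DoubleCone (connected : Connected G) {x x' a b c d : Fin n} (cycle : Cycle4 a b c d)
      (x~a : Adj G x a) (x~b : Adj G x b) (x~c : Adj G x c) (x~d : Adj G x d)
      (x'~a : Adj G x' a) (x'~b : Adj G x' b) (x'~c : Adj G x' c) (x'~d : Adj G x' d)
      (x≢x' : x ≢ x') (x≁x' : ¬ Adj G x x') where

      open Cycle4 cycle

      cycle-xbx'd : Cycle4 x b x' d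
      cycle-xbx'd = record
        { a~b = x~b ; b~c = Adj-sym x'~b ; c~d = x'~d ; d~a = Adj-sym x~d
        ; a≁c = x≁x' ; b≁d = b≁d ; a≢c = x≢x' ; b≢d = b≢d }

      -- the numbering matches the parts {0,1}, {2,3}, {4,5} of octE
      vertex : Fin 6 → Fin n
      vertex i₀ = x
      vertex i₁ = x'
      vertex i₂ = a
      vertex i₃ = c
      vertex i₄ = b
      vertex i₅ = d

      cycle-xax'c : Cycle4 x a x' c
      cycle-xax'c = record
        { a~b = x~a ; b~c = Adj-sym x'~a ; c~d = x'~c ; d~a = Adj-sym x~c
        ; a≁c = x≁x' ; b≁d = a≁c ; a≢c = x≢x' ; b≢d = a≢c }

      N[x] : C4Neighbourhood x a b c d
      N[x] = cone⇒C4Neighbourhood cycle x~a x~b x~c x~d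
      N[x'] : C4Neighbourhood x' a b c d
      N[x'] = cone⇒C4Neighbourhood cycle x'~a x'~b x'~c x'~d
      N[a] : C4Neighbourhood a x b x' d
      N[a] = cone⇒C4Neighbourhood cycle-xbx'd (Adj-sym x~a) a~b (Adj-sym x'~a) (Adj-sym d~a)
      N[c] : C4Neighbourhood c x b x' d
      N[c] = cone⇒C4Neighbourhood cycle-xbx'd (Adj-sym x~c) (Adj-sym b~c) (Adj-sym x'~c) c~d
      N[b] : C4Neighbourhood b x a x' c
      N[b] = cone⇒C4Neighbourhood cycle-xax'c (Adj-sym x~b) (Adj-sym a~b) (Adj-sym x'~b) b~c
      N[d] : C4Neighbourhood d x a x' c
      N[d] = cone⇒C4Neighbourhood cycle-xax'c (Adj-sym x~d) d~a (Adj-sym x'~d) (Adj-sym c~d)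

      IsVertex : Fin n → Set
      IsVertex v = ∃ λ i → vertex i ≡ v

      among : ∀ i j k l {v} → v ≡ vertex i ⊎ v ≡ vertex j ⊎ v ≡ vertex k ⊎ v ≡ vertex l → IsVertex v
      among i j k l (inj₁ refl)               = i , refl
      among i j k l (inj₂ (inj₁ refl))        = j , refl
      among i j k l (inj₂ (inj₂ (inj₁ refl))) = k , refl
      among i j k l (inj₂ (inj₂ (inj₂ refl))) = l , refl

      IsVertex-closed : ∀ {u v} → IsVertex u → Adj G u v → IsVertex v
      IsVertex-closed (i₀ , refl) = among i₂ i₄ i₃ i₅ ∘ C4Neighbourhood.neighbours N[x]
      IsVertex-closed (i₁ , refl) = among i₂ i₄ i₃ i₅ ∘ C4Neighbourhood.neighbours N[x']
      IsVertex-closed (i₂ , refl) = among i₀ i₄ i₁ i₅ ∘ C4Neighbourhood.neighbours N[a]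
      IsVertex-closed (i₃ , refl) = among i₀ i₄ i₁ i₅ ∘ C4Neighbourhood.neighbours N[c]
      IsVertex-closed (i₄ , refl) = among i₀ i₂ i₁ i₃ ∘ C4Neighbourhood.neighbours N[b]
      IsVertex-closed (i₅ , refl) = among i₀ i₂ i₁ i₃ ∘ C4Neighbourhood.neighbours N[d]

      covers : ∀ v → IsVertex v
      covers = Adj-closed⇒universal connected IsVertex IsVertex-closed (i₀ , refl)

      table : ∀ i j → E G (vertex i) (vertex j) ≡ octE i j
      table i₀ i₀ = irref G x
      table i₀ i₁ = ¬Adj⇒E≡false x≁x'
      table i₀ i₂ = Adj⇒E≡true x~a
      table i₀ i₃ = Adj⇒E≡true x~c
      table i₀ i₄ = Adj⇒E≡true x~b
      table i₀ i₅ = Adj⇒E≡true x~d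
      table i₁ i₀ = ¬Adj⇒E≡false (x≁x' ∘ Adj-sym)
      table i₁ i₁ = irref G x'
      table i₁ i₂ = Adj⇒E≡true x'~a
      table i₁ i₃ = Adj⇒E≡true x'~c
      table i₁ i₄ = Adj⇒E≡true x'~b
      table i₁ i₅ = Adj⇒E≡true x'~d
      table i₂ i₀ = Adj⇒E≡true (Adj-sym x~a)
      table i₂ i₁ = Adj⇒E≡true (Adj-sym x'~a)
      table i₂ i₂ = irref G a
      table i₂ i₃ = ¬Adj⇒E≡false a≁c
      table i₂ i₄ = Adj⇒E≡true a~b
      table i₂ i₅ = Adj⇒E≡true (Adj-sym d~a)
      table i₃ i₀ = Adj⇒E≡true (Adj-sym x~c)
      table i₃ i₁ = Adj⇒E≡true (Adj-sym x'~c)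
      table i₃ i₂ = ¬Adj⇒E≡false (a≁c ∘ Adj-sym)
      table i₃ i₃ = irref G c
      table i₃ i₄ = Adj⇒E≡true (Adj-sym b~c)
      table i₃ i₅ = Adj⇒E≡true c~d
      table i₄ i₀ = Adj⇒E≡true (Adj-sym x~b)
      table i₄ i₁ = Adj⇒E≡true (Adj-sym x'~b)
      table i₄ i₂ = Adj⇒E≡true (Adj-sym a~b)
      table i₄ i₃ = Adj⇒E≡true b~c
      table i₄ i₄ = irref G b
      table i₄ i₅ = ¬Adj⇒E≡false b≁d
      table i₅ i₀ = Adj⇒E≡true (Adj-sym x~d)
      table i₅ i₁ = Adj⇒E≡true (Adj-sym x'~d)
      table i₅ i₂ = Adj⇒E≡true d~a
      table i₅ i₃ = Adj⇒E≡true (Adj-sym c~d)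
      table i₅ i₄ = ¬Adj⇒E≡false (b≁d ∘ Adj-sym)
      table i₅ i₅ = irref G d

      antipodes-distinct : ∀ i → vertex i ≢ vertex (antipode i)
      antipodes-distinct i₀ = x≢x'
      antipodes-distinct i₁ = x≢x' ∘ sym
      antipodes-distinct i₂ = a≢c
      antipodes-distinct i₃ = a≢c ∘ sym
      antipodes-distinct i₄ = b≢d
      antipodes-distinct i₅ = b≢d ∘ sym

      vertex-injective : ∀ i j → vertex i ≡ vertex j → i ≡ j
      vertex-injective i j vi≡vj
        with octE≡false⇒antipodal i j (trans (sym (table i j)) (subst (λ v → E G (vertex i) v ≡ false) vi≡vj (irref G (vertex i))))
      ... | inj₁ i≡j  = i≡j
      ... | inj₂ refl = contradiction vi≡vj (antipodes-distinct i)

      double-cone⇒octahedron : IsOctahedron G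
      double-cone⇒octahedron =
        mk↔ₛ′ index vertex (λ i → vertex-injective _ i (proj₂ (covers (vertex i)))) (proj₂ ∘ covers) ,
        λ u v → subst₂ (λ u' v' → E G u' v' ≡ octE (index u) (index v)) (proj₂ (covers u)) (proj₂ (covers v)) (table (index u) (index v))
        where
        index : Fin n → Fin 6
        index v = proj₁ (covers v)


-- Two inner triangles sharing an edge

module Kite {n : ℕ} (G : Graph n) (deg : MaxDegreeAtMost G 4) {x y z w : Fin n}
  (inner-xyz : IsInnerTriangle G (⁅ x ⁆ ∪ ⁅ y ⁆ ∪ ⁅ z ⁆))
  (inner-xyw : IsInnerTriangle G (⁅ x ⁆ ∪ ⁅ y ⁆ ∪ ⁅ w ⁆))
  (z≢w : z ≢ w) where

  open GraphProperties G
  open MaxDegree4 deg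

  clique-xyz : IsClique G (⁅ x ⁆ ∪ ⁅ y ⁆ ∪ ⁅ z ⁆)
  clique-xyz = proj₁ (proj₂ inner-xyz)

  x~y : Adj G x y
  x~y = proj₁ (triangle-edges (proj₁ inner-xyz))
  x~z : Adj G x z
  x~z = proj₁ (proj₂ (triangle-edges (proj₁ inner-xyz)))
  y~z : Adj G y z
  y~z = proj₂ (proj₂ (triangle-edges (proj₁ inner-xyz)))
  x~w : Adj G x w
  x~w = proj₁ (proj₂ (triangle-edges (proj₁ inner-xyw)))
  y~w : Adj G y w
  y~w = proj₂ (proj₂ (triangle-edges (proj₁ inner-xyw)))

  z≁w : ¬ Adj G z w
  z≁w z~w = triangle-clique⇒no-common-neighbour clique-xyz x~w y~w z~w

  opaque
    apex-xz : ∃ λ a → a ∉ ⁅ x ⁆ ∪ ⁅ y ⁆ ∪ ⁅ z ⁆ × Adj G x a × Adj G z a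
    apex-xz = inner-edge-apex inner-xyz (x∈⁅y⁆∪⁅z⁆∪⁅w⁆⁺ (inj₁ refl)) (x∈⁅y⁆∪⁅z⁆∪⁅w⁆⁺ (inj₂ (inj₂ refl))) (Adj⇒≢ x~z)

  a : Fin n
  a = proj₁ apex-xz

  x~a : Adj G x a
  x~a = proj₁ (proj₂ (proj₂ apex-xz))
  z~a : Adj G z a
  z~a = proj₂ (proj₂ (proj₂ apex-xz))

  y≢a : y ≢ a
  y≢a y≡a = proj₁ (proj₂ apex-xz) (x∈⁅y⁆∪⁅z⁆∪⁅w⁆⁺ (inj₂ (inj₁ (sym y≡a))))

  y≁a : ¬ Adj G y a
  y≁a y~a = triangle-clique⇒no-common-neighbour clique-xyz x~a y~a z~a

  neighbours-x : ∀ {v} → Adj G x v → v ≡ y ⊎ v ≡ z ⊎ v ≡ a ⊎ v ≡ w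
  neighbours-x = four-neighbours x~y x~z x~a x~w
    ((Adj⇒≢ y~z ∷ y≢a ∷ Adj⇒≢ y~w ∷ []) ∷ (Adj⇒≢ z~a ∷ z≢w ∷ []) ∷ ((λ a≡w → z≁w (subst (Adj G z) a≡w z~a)) ∷ []) ∷ [] ∷ [])

  w~a : Adj G w a
  w~a with b , b∉xyw , x~b , w~b ← inner-edge-apex inner-xyw (x∈⁅y⁆∪⁅z⁆∪⁅w⁆⁺ (inj₁ refl)) (x∈⁅y⁆∪⁅z⁆∪⁅w⁆⁺ (inj₂ (inj₂ refl))) (Adj⇒≢ x~w)
    with neighbours-x x~b
  ... | inj₁ refl               = contradiction (x∈⁅y⁆∪⁅z⁆∪⁅w⁆⁺ (inj₂ (inj₁ refl))) b∉xyw
  ... | inj₂ (inj₁ refl)        = contradiction (Adj-sym w~b) z≁w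
  ... | inj₂ (inj₂ (inj₁ refl)) = w~b
  ... | inj₂ (inj₂ (inj₂ refl)) = contradiction (x∈⁅y⁆∪⁅z⁆∪⁅w⁆⁺ (inj₂ (inj₂ refl))) b∉xyw

  cycle : Cycle4 y z a w
  cycle = record
    { a~b = y~z ; b~c = z~a ; c~d = Adj-sym w~a ; d~a = Adj-sym y~w
    ; a≁c = y≁a ; b≁d = z≁w ; a≢c = y≢a ; b≢d = z≢w }

  N[x] : C4Neighbourhood x y z a w
  N[x] = cone⇒C4Neighbourhood cycle x~y x~z x~a x~w

  inner-through-xy : ∀ {q} → IsInnerTriangle G q → x ∈ q → y ∈ q →
                     q ≡ ⁅ x ⁆ ∪ ⁅ y ⁆ ∪ ⁅ z ⁆ ⊎ q ≡ ⁅ x ⁆ ∪ ⁅ y ⁆ ∪ ⁅ w ⁆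
  inner-through-xy ((complete , ∣q∣≡3) , _) x∈q y∈q
    with v , v≢x , v≢y , refl ← ∣p∣≡3⇒≡⁅x⁆∪⁅y⁆∪⁅_⁆ ∣q∣≡3 x∈q y∈q (Adj⇒≢ x~y)
    with neighbours-x (complete x v x∈q (x∈⁅y⁆∪⁅z⁆∪⁅w⁆⁺ (inj₂ (inj₂ refl))) (v≢x ∘ sym))
  ... | inj₁ refl               = contradiction refl v≢y
  ... | inj₂ (inj₁ refl)        = inj₁ refl
  ... | inj₂ (inj₂ (inj₁ refl)) = contradiction (complete y a y∈q (x∈⁅y⁆∪⁅z⁆∪⁅w⁆⁺ (inj₂ (inj₂ refl))) y≢a) y≁a
  ... | inj₂ (inj₂ (inj₂ refl)) = inj₂ refl

  inner-through-xz : ∀ {c q} → (∀ {v} → Adj G z v → v ≡ x ⊎ v ≡ y ⊎ v ≡ a ⊎ v ≡ c) → ¬ Adj G a c →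
                     IsInnerTriangle G q → x ∈ q → z ∈ q → q ≡ ⁅ x ⁆ ∪ ⁅ y ⁆ ∪ ⁅ z ⁆
  inner-through-xz neighbours-z a≁c inner-q@((complete , ∣q∣≡3) , _) x∈q z∈q
    with v , v≢x , v≢z , refl ← ∣p∣≡3⇒≡⁅x⁆∪⁅y⁆∪⁅_⁆ ∣q∣≡3 x∈q z∈q (Adj⇒≢ x~z)
    with neighbours-x (complete x v x∈q (x∈⁅y⁆∪⁅z⁆∪⁅w⁆⁺ (inj₂ (inj₂ refl))) (v≢x ∘ sym))
  ... | inj₁ refl               = cong (⁅ x ⁆ ∪_) (∪-comm ⁅ z ⁆ ⁅ y ⁆)
  ... | inj₂ (inj₁ refl)        = contradiction refl v≢z
  ... | inj₂ (inj₂ (inj₂ refl)) = contradiction (complete z w z∈q (x∈⁅y⁆∪⁅z⁆∪⁅w⁆⁺ (inj₂ (inj₂ refl))) z≢w) z≁w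
  ... | inj₂ (inj₂ (inj₁ refl))
    with u , u∉q , z~u , a~u ← inner-edge-apex inner-q z∈q (x∈⁅y⁆∪⁅z⁆∪⁅w⁆⁺ (inj₂ (inj₂ refl))) (Adj⇒≢ z~a)
    with neighbours-z z~u
  ... | inj₁ refl               = contradiction x∈q u∉q
  ... | inj₂ (inj₁ refl)        = contradiction (Adj-sym a~u) y≁a
  ... | inj₂ (inj₂ (inj₁ refl)) = contradiction a~u Adj-irrefl
  ... | inj₂ (inj₂ (inj₂ refl)) = contradiction a~u a≁c

module TwoInnerTriangles {n : ℕ} {G : Graph n} (connected : Connected G) (deg : MaxDegreeAtMost G 4)
  (not-octahedron : ¬ IsOctahedron G) {x y z w : Fin n}
  (inner-xyz : IsInnerTriangle G (⁅ x ⁆ ∪ ⁅ y ⁆ ∪ ⁅ z ⁆))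
  (inner-xyw : IsInnerTriangle G (⁅ x ⁆ ∪ ⁅ y ⁆ ∪ ⁅ w ⁆))
  (z≢w : z ≢ w) where

  open GraphProperties G
  open MaxDegree4 deg

  xy≡yx : ∀ v → ⁅ x ⁆ ∪ ⁅ y ⁆ ∪ ⁅ v ⁆ ≡ ⁅ y ⁆ ∪ ⁅ x ⁆ ∪ ⁅ v ⁆
  xy≡yx = ⁅x⁆∪⁅y⁆∪⁅z⁆≡⁅y⁆∪⁅x⁆∪⁅z⁆ x y

  module X = Kite G deg inner-xyz inner-xyw z≢w
  module Y = Kite G deg (subst (IsInnerTriangle G) (xy≡yx z) inner-xyz) (subst (IsInnerTriangle G) (xy≡yx w) inner-xyw) z≢w

  open X using (a; x~y; x~z; y~z; x~w; y~w; x~a; z~a; z≁w; y≢a; y≁a)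

  c : Fin n
  c = Y.a
  y~c : Adj G y c
  y~c = Y.x~a
  z~c : Adj G z c
  z~c = Y.z~a
  w~c : Adj G w c
  w~c = Y.w~a
  x≢c : x ≢ c
  x≢c = Y.y≢a
  x≁c : ¬ Adj G x c
  x≁c = Y.y≁a

  N[x] : C4Neighbourhood x y z a w
  N[x] = X.N[x]

  N[y] : C4Neighbourhood y x z c w
  N[y] = Y.N[x]

  clique-xza : IsClique G (⁅ x ⁆ ∪ ⁅ z ⁆ ∪ ⁅ a ⁆)
  clique-xza = C4Neighbourhood⇒triangle-clique (rotate-C4Neighbourhood N[x])

  clique-yzc : IsClique G (⁅ y ⁆ ∪ ⁅ z ⁆ ∪ ⁅ c ⁆)
  clique-yzc = C4Neighbourhood⇒triangle-clique (rotate-C4Neighbourhood N[y])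

  a≁c : ¬ Adj G a c
  a≁c a~c = not-octahedron (DoubleCone.double-cone⇒octahedron connected X.cycle
    x~y x~z x~a x~w (Adj-sym y~c) (Adj-sym z~c) (Adj-sym a~c) (Adj-sym w~c) x≢c x≁c)

  a≢c : a ≢ c
  a≢c a≡c = x≁c (subst (Adj G x) a≡c x~a)

  neighbours-z : ∀ {v} → Adj G z v → v ≡ x ⊎ v ≡ y ⊎ v ≡ a ⊎ v ≡ c
  neighbours-z = four-neighbours (Adj-sym x~z) (Adj-sym y~z) z~a z~c
    ((Adj⇒≢ x~y ∷ Adj⇒≢ x~a ∷ x≢c ∷ []) ∷ (y≢a ∷ Adj⇒≢ y~c ∷ []) ∷ (a≢c ∷ []) ∷ [] ∷ [])

  within-star-z : ∀ {q v} → IsClique G q → z ∈ q → v ∈ q → v ≡ z ⊎ v ≡ x ⊎ v ≡ y ⊎ v ≡ a ⊎ v ≡ c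
  within-star-z {v = v} (complete , _) z∈q v∈q with v ≟ z
  ... | yes v≡z = inj₁ v≡z
  ... | no v≢z  = inj₂ (neighbours-z (complete z v z∈q v∈q (v≢z ∘ sym)))

  xyw≢xyz : ⁅ x ⁆ ∪ ⁅ y ⁆ ∪ ⁅ w ⁆ ≢ ⁅ x ⁆ ∪ ⁅ y ⁆ ∪ ⁅ z ⁆
  xyw≢xyz xyw≡xyz with x∈⁅y⁆∪⁅z⁆∪⁅w⁆⁻ x y z (subst (w ∈_) xyw≡xyz (x∈⁅y⁆∪⁅z⁆∪⁅w⁆⁺ (inj₂ (inj₂ refl))))
  ... | inj₁ w≡x        = Adj⇒≢ x~w (sym w≡x)
  ... | inj₂ (inj₁ w≡y) = Adj⇒≢ y~w (sym w≡y)
  ... | inj₂ (inj₂ w≡z) = z≢w (sym w≡z)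

  xyw-ear : IsEar G (⁅ x ⁆ ∪ ⁅ y ⁆ ∪ ⁅ z ⁆) (⁅ x ⁆ ∪ ⁅ y ⁆ ∪ ⁅ w ⁆)
  xyw-ear = (proj₁ (proj₂ inner-xyw) , length≤∣p∣ ((Adj⇒≢ x~y ∷ []) ∷ [] ∷ []) (∈both (inj₁ refl) ∷ ∈both (inj₂ refl) ∷ []))
          , xyw≢xyz
    where
    ∈both : ∀ {v} → v ≡ x ⊎ v ≡ y → v ∈ (⁅ x ⁆ ∪ ⁅ y ⁆ ∪ ⁅ w ⁆) ∩ (⁅ x ⁆ ∪ ⁅ y ⁆ ∪ ⁅ z ⁆)
    ∈both v≡ = x∈p∩q⁺ (x∈⁅y⁆∪⁅z⁆∪⁅w⁆⁺ (map₂ inj₁ v≡) , x∈⁅y⁆∪⁅z⁆∪⁅w⁆⁺ (map₂ inj₁ v≡))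

  inner-ear-unique : ∀ q → IsEar G (⁅ x ⁆ ∪ ⁅ y ⁆ ∪ ⁅ z ⁆) q → IsInnerTriangle G q → q ≡ ⁅ x ⁆ ∪ ⁅ y ⁆ ∪ ⁅ w ⁆
  inner-ear-unique q ((_ , 2≤∣q∩xyz∣) , q≢xyz) inner-q with two-of-three 2≤∣q∩xyz∣
  ... | inj₁ (x∈q , y∈q) with X.inner-through-xy inner-q x∈q y∈q
  ...   | inj₁ q≡xyz = contradiction q≡xyz q≢xyz
  ...   | inj₂ q≡xyw = q≡xyw
  inner-ear-unique q ((_ , _) , q≢xyz) inner-q | inj₂ (inj₁ (x∈q , z∈q)) =
    contradiction (X.inner-through-xz neighbours-z a≁c inner-q x∈q z∈q) q≢xyz
  inner-ear-unique q ((_ , _) , q≢xyz) inner-q | inj₂ (inj₂ (y∈q , z∈q)) =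
    contradiction (trans (Y.inner-through-xz neighbours-z' (a≁c ∘ Adj-sym) inner-q y∈q z∈q) (sym (xy≡yx z))) q≢xyz
    where
    neighbours-z' : ∀ {v} → Adj G z v → v ≡ y ⊎ v ≡ x ⊎ v ≡ c ⊎ v ≡ a
    neighbours-z' z~v with neighbours-z z~v
    ... | inj₁ v≡x               = inj₂ (inj₁ v≡x)
    ... | inj₂ (inj₁ v≡y)        = inj₁ v≡y
    ... | inj₂ (inj₂ (inj₁ v≡a)) = inj₂ (inj₂ (inj₂ v≡a))
    ... | inj₂ (inj₂ (inj₂ v≡c)) = inj₂ (inj₂ (inj₁ v≡c))

  -- a clique through z that misses x and y lies in {z, a, c}, hence inside x z a or y z c
  xyw-meets-star-z : MeetsStar z (⁅ x ⁆ ∪ ⁅ y ⁆ ∪ ⁅ w ⁆)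
  xyw-meets-star-z q (q-clique , z∈q) with x ∈? q | y ∈? q
  ... | yes x∈q | _ = x , x∈p∩q⁺ (x∈⁅y⁆∪⁅z⁆∪⁅w⁆⁺ (inj₁ refl) , x∈q)
  ... | no _ | yes y∈q = y , x∈p∩q⁺ (x∈⁅y⁆∪⁅z⁆∪⁅w⁆⁺ (inj₂ (inj₁ refl)) , y∈q)
  ... | no x∉q | no y∉q with c ∈? q
  ...   | no c∉q = contradiction (proj₂ q-clique _ (proj₁ clique-xza) xza (x∈⁅y⁆∪⁅z⁆∪⁅w⁆⁺ (inj₁ refl))) x∉q
    where
    xza : q ⊆ ⁅ x ⁆ ∪ ⁅ z ⁆ ∪ ⁅ a ⁆
    xza v∈q with within-star-z q-clique z∈q v∈q
    ... | inj₁ v≡z                      = x∈⁅y⁆∪⁅z⁆∪⁅w⁆⁺ (inj₂ (inj₁ v≡z))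
    ... | inj₂ (inj₁ refl)              = contradiction v∈q x∉q
    ... | inj₂ (inj₂ (inj₁ refl))       = contradiction v∈q y∉q
    ... | inj₂ (inj₂ (inj₂ (inj₁ v≡a))) = x∈⁅y⁆∪⁅z⁆∪⁅w⁆⁺ (inj₂ (inj₂ v≡a))
    ... | inj₂ (inj₂ (inj₂ (inj₂ refl))) = contradiction v∈q c∉q
  ...   | yes c∈q = contradiction (proj₂ q-clique _ (proj₁ clique-yzc) yzc (x∈⁅y⁆∪⁅z⁆∪⁅w⁆⁺ (inj₁ refl))) y∉q
    where
    yzc : q ⊆ ⁅ y ⁆ ∪ ⁅ z ⁆ ∪ ⁅ c ⁆
    yzc v∈q with within-star-z q-clique z∈q v∈q
    ... | inj₁ v≡z                      = x∈⁅y⁆∪⁅z⁆∪⁅w⁆⁺ (inj₂ (inj₁ v≡z))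
    ... | inj₂ (inj₁ refl)              = contradiction v∈q x∉q
    ... | inj₂ (inj₂ (inj₁ refl))       = contradiction v∈q y∉q
    ... | inj₂ (inj₂ (inj₂ (inj₁ refl))) = contradiction (proj₁ q-clique a c v∈q c∈q a≢c) a≁c
    ... | inj₂ (inj₂ (inj₂ (inj₂ v≡c))) = x∈⁅y⁆∪⁅z⁆∪⁅w⁆⁺ (inj₂ (inj₂ v≡c))

  z∉xyw : z ∉ ⁅ x ⁆ ∪ ⁅ y ⁆ ∪ ⁅ w ⁆
  z∉xyw z∈xyw with x∈⁅y⁆∪⁅z⁆∪⁅w⁆⁻ x y w z∈xyw
  ... | inj₁ z≡x        = Adj⇒≢ x~z (sym z≡x)
  ... | inj₂ (inj₁ z≡y) = Adj⇒≢ y~z (sym z≡y)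
  ... | inj₂ (inj₂ z≡w) = z≢w z≡w

  normal-vertices-xyz : ∀ v → v ∈ ⁅ x ⁆ ∪ ⁅ y ⁆ ∪ ⁅ z ⁆ → IsNormal G v → v ≡ x ⊎ v ≡ y
  normal-vertices-xyz v v∈xyz v-normal with x∈⁅y⁆∪⁅z⁆∪⁅w⁆⁻ x y z v∈xyz
  ... | inj₁ v≡x        = inj₁ v≡x
  ... | inj₂ (inj₁ v≡y) = inj₂ v≡y
  ... | inj₂ (inj₂ refl) =
    contradiction v-normal (clique-meets-star⇒¬normal (proj₁ (proj₂ inner-xyw)) z∉xyw xyw-meets-star-z)

mainTheorem8 : ∀ {n} (G : Graph n) → Connected G → MaxDegreeAtMost G 4 → ¬ IsOctahedron G →
    ∀ (t t' : Subset n) (x y : Fin n) → IsInnerTriangle G t → IsInnerTriangle G t' →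
    x ≢ y → (t ∩ t') ≡ (⁅ x ⁆ ∪ ⁅ y ⁆) →
    InducesC4 G (N G x) ×
    (IsEar G t t' × (∀ q → IsEar G t q → IsInnerTriangle G q → q ≡ t')) ×
    (IsNormal G x × IsNormal G y × (∀ z → z ∈ t → IsNormal G z → z ≡ x ⊎ z ≡ y))
mainTheorem8 G connected deg not-octahedron t t' x y inner-t inner-t' x≢y t∩t'≡xy
  with z , w , z≢w , refl , refl ← ∣p∣≡∣q∣≡3∧p∩q≡⁅x⁆∪⁅y⁆⇒ (proj₂ (proj₁ inner-t)) (proj₂ (proj₁ inner-t')) x≢y t∩t'≡xy
  = C4Neighbourhood⇒InducesC4 N[x]
  , (xyw-ear , inner-ear-unique)
  , (C4Neighbourhood⇒normal N[x] , C4Neighbourhood⇒normal N[y] , normal-vertices-xyz)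
  where
  open GraphProperties G
  open TwoInnerTriangles connected deg not-octahedron inner-t inner-t' z≢w
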